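{- For all integers $n,m\ge 1$, the bistar graph with parameters $n,m$ is a difference graph.
   Context: A graph $G=(V,E)$ is a difference graph if there is a bijection $f$ from $V$ onto a set $S$ of positive integers such that for all distinct $x,y\in V$: $xy\in E$ if and only if $|f(x)-f(y)|\in S$. The bistar graph with parameters $n,m$ has vertices $u_0,u_1,\dots,u_n,v_0,v_1,\dots,v_m$ and edges $u_0u_i$ ($1\le i\le n$), $v_0v_j$ ($1\le j\le m$) and $u_0v_0$; i.e. the centres of the stars $K_{1,n}$ and $K_{1,m}$ joined by an edge. -}

module Defs where

open import Data.Nat using (ℕ; _<_; ∣_-_∣)
open import Data.Fin using (Fin)
open import Data.Product using (Σ; ∃; _×_)
open import Relation.Binary.PropositionalEquality using (_≡_; _≢_)
open import Function.Bundles using (_⇔_)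
open import Function.Definitions using (Injective)

record Graph : Set₁ where
  field
    Vertex : Set
    Adj    : Vertex → Vertex → Set

open Graph public

-- G is a difference graph: there is an injective f : V → ℕ taking positive
-- values (so f is a bijection from V onto S := image of f, a set of positive
-- integers) such that for distinct x y, x ~ y iff |f x - f y| ∈ S.
IsDifferenceGraph : Graph → Set
IsDifferenceGraph G =
  Σ (Vertex G → ℕ) λ f →
    Injective _≡_ _≡_ f
    × (∀ x → 0 < f x)
    × (∀ x y → x ≢ y → (Adj G x y ⇔ (∃ λ z → f z ≡ ∣ f x - f y ∣)))

data BVertex (n m : ℕ) : Set where
  u₀ : BVertex n m
  u  : Fin n → BVertex n m
  v₀ : BVertex n m
  v  : Fin m → BVertex n m

data BAdj {n m : ℕ} : BVertex n m → BVertex n m → Set where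
  u₀-u  : ∀ i → BAdj u₀ (u i)
  u-u₀  : ∀ i → BAdj (u i) u₀
  v₀-v  : ∀ j → BAdj v₀ (v j)
  v-v₀  : ∀ j → BAdj (v j) v₀
  u₀-v₀ : BAdj u₀ v₀
  v₀-u₀ : BAdj v₀ u₀

Bistar : ℕ → ℕ → Graph
Bistar n m = record { Vertex = BVertex n m ; Adj = BAdj }

module Submission where

open import Defs
open import Data.Bool using (Bool; true; false; T; _∨_)
open import Data.Bool.Properties using (T-∨)
open import Data.Nat using (ℕ; _≥_; zero; suc; _+_; _*_; _∸_; _≤_; _<_; z≤n; z<s; s≤s; s≤s⁻¹; ∣_-_∣)
open import Data.Nat.Properties
open import Data.Nat.Tactic.RingSolver using (solve-∀)
open import Data.Fin using (Fin; zero; suc; toℕ; opposite)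
open import Data.Fin.Properties using (toℕ<n; toℕ-injective; opposite-prop)
open import Data.Product using (∃; _×_; _,_; proj₁; proj₂; map₂)
open import Data.Sum as Sum using (_⊎_; inj₁; inj₂)
open import Data.Empty using (⊥-elim)
open import Function using (_∘_)
open import Function.Definitions using (Injective)
open import Function.Bundles using (Equivalence; mk⇔)
open import Relation.Binary.PropositionalEquality

-- Label each vertex k·a + s with offset s < a, where a exceeds every offset used,
-- and call k its band. The leaves of u₀ go to band 2, u₀ to band 4, the leaves
-- v (suc j) to band 10, v zero to band 16 and v₀ to band 20, with offsets chosen
-- so that the labels of a leaf and of its opposite leaf add up to the label of
-- their centre, and those of u₀ and v zero add up to that of v₀: this yields every
-- edge. A difference of labels in bands k > l lies in band k ∸ l ∸ 1 or k ∸ l, one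
-- of labels in a common band in band 0; for the non-adjacent pairs these are bands
-- 0, 5–8, 11–14, 17 and 18, none of which holds a label.

InBand : ℕ → ℕ → ℕ → Set
InBand a k x = k * a ≤ x × x < suc k * a

inBand-+ : ∀ {a s} k → s < a → InBand a k (k * a + s)
inBand-+ {a} k s<a = m≤m+n (k * a) _ , ≤-trans (+-monoʳ-< (k * a) s<a) (≤-reflexive (+-comm (k * a) a))

band-index-≤ : ∀ {a k l x} → k * a ≤ x → x < suc l * a → k ≤ l
band-index-≤ {a} {k} {l} k*a≤x x<1+l*a = s≤s⁻¹ (*-cancelʳ-< a k (suc l) (≤-<-trans k*a≤x x<1+l*a))

inBand-index-range : ∀ {a r l h w} → InBand a r w → l * a ≤ w → w < suc h * a → l ≤ r × r ≤ h
inBand-index-range (r*a≤w , w<1+r*a) l*a≤w w<1+h*a = band-index-≤ l*a≤w w<1+r*a , band-index-≤ r*a≤w w<1+h*a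

inBand-unique : ∀ {a k l x} → InBand a k x → InBand a l x → k ≡ l
inBand-unique inK (l*a≤x , x<1+l*a) with inBand-index-range inK l*a≤x x<1+l*a
... | l≤k , k≤l = ≤-antisym k≤l l≤k

∸-bounds : ∀ {x y lo hi} → lo + y ≤ x → x < y + hi → lo ≤ x ∸ y × x ∸ y < hi
∸-bounds {x} {y} {lo} {hi} lo+y≤x x<y+hi =
  m+n≤o⇒m≤o∸n lo lo+y≤x ,
  +-cancelˡ-< y (x ∸ y) hi (subst (_< y + hi) (sym (m+[n∸m]≡n (≤-trans (m≤n+m y lo) lo+y≤x))) x<y+hi)

inBand-∸-below : ∀ {a k x y} → InBand a k x → k * a ≤ y → x ∸ y < a
inBand-∸-below {a} {k} {x} (k*a≤x , x<1+k*a) k*a≤y =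
  ≤-<-trans (∸-monoʳ-≤ x k*a≤y) (proj₂ (∸-bounds {lo = 0} k*a≤x (subst (x <_) (+-comm a (k * a)) x<1+k*a)))

inBand-∣-∣-same : ∀ {a k x y} → InBand a k x → InBand a k y → ∣ x - y ∣ < a
inBand-∣-∣-same {a} {k} {x} {y} inX inY with ∣m-n∣≡[m∸n]∨[n∸m] x y
... | inj₁ ∣x-y∣≡x∸y = subst (_< a) (sym ∣x-y∣≡x∸y) (inBand-∸-below {k = k} inX (proj₁ inY))
... | inj₂ ∣x-y∣≡y∸x = subst (_< a) (sym ∣x-y∣≡y∸x) (inBand-∸-below {k = k} inY (proj₁ inX))

inBand-∣-∣-apart : ∀ {a d l x y} → InBand a (suc d + l) x → InBand a l y →
                   d * a ≤ ∣ x - y ∣ × ∣ x - y ∣ < suc (suc d) * a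
inBand-∣-∣-apart {a} {d} {l} {x} {y} (lower , upper) (l*a≤y , y<1+l*a) =
  subst (λ w → d * a ≤ w × w < suc (suc d) * a) (sym (m≤n⇒∣n-m∣≡n∸m y≤x)) (∸-bounds d*a+y≤x x<y+2+d*a)
  where
  d*a+y≤x : d * a + y ≤ x
  d*a+y≤x = ≤-trans (+-monoʳ-≤ (d * a) (<⇒≤ y<1+l*a))
                    (subst (_≤ x) (lower-split d l a) lower)
    where
    lower-split : ∀ d l a → (suc d + l) * a ≡ d * a + suc l * a
    lower-split = solve-∀
  y≤x : y ≤ x
  y≤x = ≤-trans (m≤n+m y (d * a)) d*a+y≤x
  x<y+2+d*a : x < y + suc (suc d) * a
  x<y+2+d*a = ≤-trans (subst (x <_) (upper-split d l a) upper)
                      (+-monoˡ-≤ (suc (suc d) * a) l*a≤y)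
    where
    upper-split : ∀ d l a → suc (suc d + l) * a ≡ l * a + suc (suc d) * a
    upper-split = solve-∀

band-index-cases : ∀ {d r} → d ≤ r → r ≤ suc d → r ≡ d ⊎ r ≡ suc d
band-index-cases d≤r r≤1+d with m≤n⇒m<n∨m≡n d≤r
... | inj₁ d<r = inj₂ (≤-antisym r≤1+d d<r)
... | inj₂ d≡r = inj₁ (sym d≡r)

*+-interchange : ∀ k l a s t → (k * a + s) + (l * a + t) ≡ (k + l) * a + (s + t)
*+-interchange = solve-∀

∣-∣-split : ∀ x y {z} → z ≡ x + y → ∣ z - x ∣ ≡ y
∣-∣-split x y refl = trans (∣-∣-comm (x + y) x) (∣m-m+n∣≡n x y)

toℕ-+-opposite : ∀ {n} (i : Fin n) → suc (toℕ i + toℕ (opposite i)) ≡ n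
toℕ-+-opposite i = trans (cong (λ t → suc (toℕ i + t)) (opposite-prop i)) (m+[n∸m]≡n (toℕ<n i))

module BistarLabelling (p q : ℕ) where

  Vertex′ : Set
  Vertex′ = BVertex (suc p) (suc q)

  a : ℕ
  a = suc (p + (p + suc q))

  band : Vertex′ → ℕ
  band u₀ = 4
  band (u _) = 2
  band v₀ = 20
  band (v zero) = 16
  band (v (suc _)) = 10

  offset : Vertex′ → ℕ
  offset u₀ = p
  offset (u i) = toℕ i
  offset v₀ = p + (p + suc q)
  offset (v zero) = p + suc q
  offset (v (suc j)) = p + suc (toℕ j)

  f : Vertex′ → ℕ
  f z = band z * a + offset z

  offset<a : ∀ z → offset z < a
  offset<a u₀ = s≤s (m≤m+n p _)
  offset<a (u i) = s≤s (≤-trans (s≤s⁻¹ (toℕ<n i)) (m≤m+n p _))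
  offset<a v₀ = ≤-refl
  offset<a (v zero) = s≤s (+-monoʳ-≤ p (m≤n+m (suc q) p))
  offset<a (v (suc j)) = s≤s (+-monoʳ-≤ p (≤-trans (m≤n⇒m≤1+n (toℕ<n j)) (m≤n+m (suc q) p)))

  f-inBand : ∀ z → InBand a (band z) (f z)
  f-inBand z = inBand-+ (band z) (offset<a z)

  f-positive : ∀ z → 0 < f z
  f-positive u₀ = z<s
  f-positive (u _) = z<s
  f-positive v₀ = z<s
  f-positive (v zero) = z<s
  f-positive (v (suc _)) = z<s

  isLabelBand : ℕ → Bool
  isLabelBand 2 = true
  isLabelBand 4 = true
  isLabelBand 10 = true
  isLabelBand 16 = true
  isLabelBand 20 = true
  isLabelBand _ = false

  band-isLabelBand : ∀ z → T (isLabelBand (band z))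
  band-isLabelBand u₀ = _
  band-isLabelBand (u _) = _
  band-isLabelBand v₀ = _
  band-isLabelBand (v zero) = _
  band-isLabelBand (v (suc _)) = _

  DiffIsLabel : Vertex′ → Vertex′ → Set
  DiffIsLabel x y = ∃ λ z → f z ≡ ∣ f x - f y ∣

  DiffIsLabel-sym : ∀ x y → DiffIsLabel x y → DiffIsLabel y x
  DiffIsLabel-sym x y = map₂ (λ e → trans e (∣-∣-comm (f x) (f y)))

  diff-inBand : ∀ x y z → f z ≡ ∣ f x - f y ∣ → InBand a (band z) ∣ f x - f y ∣
  diff-inBand _ _ z fz≡w = subst (InBand a (band z)) fz≡w (f-inBand z)

  no-label-within : ∀ x y → band x ≡ band y → DiffIsLabel x y → T (isLabelBand 0)
  no-label-within x y bx≡by (z , fz≡w) =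
    subst (T ∘ isLabelBand) (n≤0⇒n≡0 band-z≤0) (band-isLabelBand z)
    where
    w<1*a : ∣ f x - f y ∣ < 1 * a
    w<1*a = subst (∣ f x - f y ∣ <_) (sym (+-identityʳ a))
                  (inBand-∣-∣-same {k = band y} (subst (λ k → InBand a k (f x)) bx≡by (f-inBand x)) (f-inBand y))
    band-z≤0 : band z ≤ 0
    band-z≤0 = proj₂ (inBand-index-range {l = 0} (diff-inBand x y z fz≡w) z≤n w<1*a)

  no-label-across : ∀ d x y → band x ≡ suc d + band y → DiffIsLabel x y →
                    T (isLabelBand d ∨ isLabelBand (suc d))
  no-label-across d x y bx≡1+d+by (z , fz≡w) =
    Equivalence.from T-∨ (Sum.map labelBand labelBand (band-index-cases (proj₁ range) (proj₂ range)))
    where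
    labelBand : ∀ {r} → band z ≡ r → T (isLabelBand r)
    labelBand band-z≡r = subst (T ∘ isLabelBand) band-z≡r (band-isLabelBand z)
    bounds : d * a ≤ ∣ f x - f y ∣ × ∣ f x - f y ∣ < suc (suc d) * a
    bounds = inBand-∣-∣-apart {d = d} {l = band y} (subst (λ k → InBand a k (f x)) bx≡1+d+by (f-inBand x)) (f-inBand y)
    range : d ≤ band z × band z ≤ suc d
    range = inBand-index-range (diff-inBand x y z fz≡w) (proj₁ bounds) (proj₂ bounds)

  u₀-split : ∀ i → f u₀ ≡ f (u i) + f (u (opposite i))
  u₀-split i = sym (trans (*+-interchange 2 2 a (toℕ i) (toℕ (opposite i)))
                          (cong (4 * a +_) (suc-injective (toℕ-+-opposite i))))

  v₀-split-leaves : ∀ j → f v₀ ≡ f (v (suc j)) + f (v (suc (opposite j)))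
  v₀-split-leaves j = sym (begin
    f (v (suc j)) + f (v (suc j′))                     ≡⟨ *+-interchange 10 10 a (p + suc (toℕ j)) (p + suc (toℕ j′)) ⟩
    20 * a + ((p + suc (toℕ j)) + (p + suc (toℕ j′)))  ≡⟨ cong (20 * a +_) (regroup p (toℕ j) (toℕ j′)) ⟩
    20 * a + (p + (p + suc (suc (toℕ j + toℕ j′))))    ≡⟨ cong (λ t → 20 * a + (p + (p + suc t))) (toℕ-+-opposite j) ⟩
    f v₀                                               ∎)
    where
    open ≡-Reasoning
    j′ = opposite j
    regroup : ∀ p s t → (p + suc s) + (p + suc t) ≡ p + (p + suc (suc (s + t)))
    regroup = solve-∀

  v₀-split-centres : f v₀ ≡ f u₀ + f (v zero)
  v₀-split-centres = sym (*+-interchange 4 16 a p (p + suc q))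

  split⇒diffIsLabel : ∀ x y z → f x ≡ f y + f z → DiffIsLabel x y
  split⇒diffIsLabel x y z fx≡fy+fz = z , sym (∣-∣-split (f y) (f z) fx≡fy+fz)

  u₀-u-diff : ∀ i → DiffIsLabel u₀ (u i)
  u₀-u-diff i = split⇒diffIsLabel u₀ (u i) (u (opposite i)) (u₀-split i)

  v₀-v-diff : ∀ j → DiffIsLabel v₀ (v j)
  v₀-v-diff zero =
    split⇒diffIsLabel v₀ (v zero) u₀ (trans v₀-split-centres (+-comm (f u₀) (f (v zero))))
  v₀-v-diff (suc j) = split⇒diffIsLabel v₀ (v (suc j)) (v (suc (opposite j))) (v₀-split-leaves j)

  v₀-u₀-diff : DiffIsLabel v₀ u₀
  v₀-u₀-diff = split⇒diffIsLabel v₀ u₀ (v zero) v₀-split-centres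

  adjacent⇒diffIsLabel : ∀ {x y} → BAdj x y → DiffIsLabel x y
  adjacent⇒diffIsLabel (u₀-u i) = u₀-u-diff i
  adjacent⇒diffIsLabel (u-u₀ i) = DiffIsLabel-sym u₀ (u i) (u₀-u-diff i)
  adjacent⇒diffIsLabel (v₀-v j) = v₀-v-diff j
  adjacent⇒diffIsLabel (v-v₀ j) = DiffIsLabel-sym v₀ (v j) (v₀-v-diff j)
  adjacent⇒diffIsLabel u₀-v₀ = DiffIsLabel-sym v₀ u₀ v₀-u₀-diff
  adjacent⇒diffIsLabel v₀-u₀ = v₀-u₀-diff

  diffIsLabel⇒adjacent : ∀ x y → DiffIsLabel x y → BAdj x y
  diffIsLabel⇒adjacent u₀ u₀ h = ⊥-elim (no-label-within u₀ u₀ refl h)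
  diffIsLabel⇒adjacent u₀ (u i) _ = u₀-u i
  diffIsLabel⇒adjacent u₀ v₀ _ = u₀-v₀
  diffIsLabel⇒adjacent u₀ y@(v zero) h = ⊥-elim (no-label-across 11 y u₀ refl (DiffIsLabel-sym u₀ y h))
  diffIsLabel⇒adjacent u₀ y@(v (suc _)) h = ⊥-elim (no-label-across 5 y u₀ refl (DiffIsLabel-sym u₀ y h))
  diffIsLabel⇒adjacent (u i) u₀ _ = u-u₀ i
  diffIsLabel⇒adjacent x@(u _) y@(u _) h = ⊥-elim (no-label-within x y refl h)
  diffIsLabel⇒adjacent x@(u _) v₀ h = ⊥-elim (no-label-across 17 v₀ x refl (DiffIsLabel-sym x v₀ h))
  diffIsLabel⇒adjacent x@(u _) y@(v zero) h = ⊥-elim (no-label-across 13 y x refl (DiffIsLabel-sym x y h))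
  diffIsLabel⇒adjacent x@(u _) y@(v (suc _)) h = ⊥-elim (no-label-across 7 y x refl (DiffIsLabel-sym x y h))
  diffIsLabel⇒adjacent v₀ u₀ _ = v₀-u₀
  diffIsLabel⇒adjacent v₀ y@(u _) h = ⊥-elim (no-label-across 17 v₀ y refl h)
  diffIsLabel⇒adjacent v₀ v₀ h = ⊥-elim (no-label-within v₀ v₀ refl h)
  diffIsLabel⇒adjacent v₀ (v j) _ = v₀-v j
  diffIsLabel⇒adjacent x@(v zero) u₀ h = ⊥-elim (no-label-across 11 x u₀ refl h)
  diffIsLabel⇒adjacent x@(v zero) y@(u _) h = ⊥-elim (no-label-across 13 x y refl h)
  diffIsLabel⇒adjacent (v j) v₀ _ = v-v₀ j
  diffIsLabel⇒adjacent x@(v zero) y@(v zero) h = ⊥-elim (no-label-within x y refl h)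
  diffIsLabel⇒adjacent x@(v zero) y@(v (suc _)) h = ⊥-elim (no-label-across 5 x y refl h)
  diffIsLabel⇒adjacent x@(v (suc _)) u₀ h = ⊥-elim (no-label-across 5 x u₀ refl h)
  diffIsLabel⇒adjacent x@(v (suc _)) y@(u _) h = ⊥-elim (no-label-across 7 x y refl h)
  diffIsLabel⇒adjacent x@(v (suc _)) y@(v zero) h = ⊥-elim (no-label-across 5 y x refl (DiffIsLabel-sym x y h))
  diffIsLabel⇒adjacent x@(v (suc _)) y@(v (suc _)) h = ⊥-elim (no-label-within x y refl h)

  band-offset-injective : ∀ x y → band x ≡ band y → offset x ≡ offset y → x ≡ y
  band-offset-injective u₀ u₀ _ _ = refl
  band-offset-injective u₀ (u _) () _
  band-offset-injective u₀ v₀ () _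
  band-offset-injective u₀ (v zero) () _
  band-offset-injective u₀ (v (suc _)) () _
  band-offset-injective (u _) u₀ () _
  band-offset-injective (u _) (u _) _ i≡j = cong u (toℕ-injective i≡j)
  band-offset-injective (u _) v₀ () _
  band-offset-injective (u _) (v zero) () _
  band-offset-injective (u _) (v (suc _)) () _
  band-offset-injective v₀ u₀ () _
  band-offset-injective v₀ (u _) () _
  band-offset-injective v₀ v₀ _ _ = refl
  band-offset-injective v₀ (v zero) () _
  band-offset-injective v₀ (v (suc _)) () _
  band-offset-injective (v zero) u₀ () _
  band-offset-injective (v zero) (u _) () _
  band-offset-injective (v zero) v₀ () _
  band-offset-injective (v zero) (v zero) _ _ = refl
  band-offset-injective (v zero) (v (suc _)) () _
  band-offset-injective (v (suc _)) u₀ () _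
  band-offset-injective (v (suc _)) (u _) () _
  band-offset-injective (v (suc _)) v₀ () _
  band-offset-injective (v (suc _)) (v zero) () _
  band-offset-injective (v (suc i)) (v (suc j)) _ p+1+i≡p+1+j =
    cong (v ∘ suc) (toℕ-injective (suc-injective (+-cancelˡ-≡ p _ _ p+1+i≡p+1+j)))

  f-injective : Injective _≡_ _≡_ f
  f-injective {x} {y} fx≡fy =
    band-offset-injective x y bx≡by
      (+-cancelˡ-≡ (band x * a) _ _ (trans fx≡fy (cong (λ k → k * a + offset y) (sym bx≡by))))
    where
    bx≡by : band x ≡ band y
    bx≡by = inBand-unique (f-inBand x) (subst (InBand a (band y)) (sym fx≡fy) (f-inBand y))

  isDifferenceGraph : IsDifferenceGraph (Bistar (suc p) (suc q))
  isDifferenceGraph =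
    f , f-injective , f-positive , λ x y _ → mk⇔ adjacent⇒diffIsLabel (diffIsLabel⇒adjacent x y)

theorem3p4 : (n m : ℕ) → n ≥ 1 → m ≥ 1 → IsDifferenceGraph (Bistar n m)
theorem3p4 zero _ () _
theorem3p4 (suc _) zero _ ()
theorem3p4 (suc p) (suc q) _ _ = BistarLabelling.isDifferenceGraph p q
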